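{- For any $k$-partition with sinks $\{\hat P,\hat Y\}$ there exists a worst-case scenario $s^*\in\mathcal S$ for $\{\hat P,\hat Y\}$, with dominant part $P_d$, such that (1) $w_i(s^*)=w_i^-$ whenever $x_i\notin P_d$, and (2) the sub-scenario of $s^*$ within $P_d$ is left-dominant or right-dominant.
   Context: $P$ is a path with vertices at coordinates $x_0<\dots<x_n$; $\tau>0$. Vertex $x_i$ has weight interval $[w_i^-,w_i^+]$, $0<w_i^-\le w_i^+$; a scenario $s$ assigns $w_i(s)\in[w_i^-,w_i^+]$, and $\mathcal S$ is the set of scenarios. For a subpath $Q=\{x_l,\dots,x_r\}$, sink $y=x_t\in Q$: $\Theta_L(Q,y,s)=\max_{l\le i<t}\{(x_t-x_i)\tau+\sum_{j=l}^i w_j(s)\}$, $\Theta_R(Q,y,s)=\max_{t<i\le r}\{(x_i-x_t)\tau+\sum_{j=i}^r w_j(s)\}$ (empty maxima $0$), $\Theta^1=\max(\Theta_L,\Theta_R)$. A $k$-partition with sinks: consecutive subpaths $P_1,\dots,P_k$ partitioning the vertices with sinks $y_i\in P_i$. $\Theta^k(P,\{\hat P,\hat Y\},s)=\max_i\Theta^1(P_i,y_i,s)$; $\Theta^k_{\rm opt}(P,s)$ its minimum over all $k$-partitions with sinks; regret $=\Theta^k-\Theta^k_{\rm opt}$; a worst-case scenario maximizes regret over $\mathcal S$. Dominant part: $P_d$, $d$ the smallest index maximizing $\Theta^1(P_i,y_i,s)$. A sub-scenario on $\{x_l,\dots,x_r\}$ is left-dominant (resp. right-dominant) if for some $l\le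 i\le r$, $w_j(s)=w_j^+$ (resp. $w_j^-$) for $l\le j<i$ and $w_j(s)=w_j^-$ (resp. $w_j^+$) for $i\le j\le r$.
   Formalization: The coordinates $x_0<\dots<x_n$, the parameter τ, the weight bounds $w_i^-$, $w_i^+$ and the scenario weights $w_i(s)$ are all rational, so the scenario set 𝒮 consists of rational scenarios. -}

module Defs where

open import Data.Nat as ℕ using (ℕ; zero; suc; _∸_)
open import Data.Fin as Fin using (Fin; zero; suc; fromℕ; inject₁)
open import Data.Rational using (ℚ; 0ℚ; _+_; _*_; _-_; _⊔_; _≤_; _<_)
open import Data.Product using (Σ; ∃; _×_; _,_)
open import Data.Sum using (_⊎_)
open import Relation.Binary.PropositionalEquality using (_≡_)

-- Problem data: vertices x_0 < ... < x_n (indexed by ℕ, only 0..n matter),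
-- travel-time parameter τ, weight intervals [w⁻ i, w⁺ i].
record Data (n : ℕ) : Set where
  field
    x   : ℕ → ℚ
    τ   : ℚ
    w⁻  : ℕ → ℚ
    w⁺  : ℕ → ℚ

record Valid {n : ℕ} (D : Data n) : Set where
  open Data D
  field
    x-increasing : ∀ i → i ℕ.< n → x i < x (suc i)
    τ-pos        : 0ℚ < τ
    w⁻-pos       : ∀ i → i ℕ.≤ n → 0ℚ < w⁻ i
    w⁻≤w⁺        : ∀ i → i ℕ.≤ n → w⁻ i ≤ w⁺ i

Scenario : Set
Scenario = ℕ → ℚ

IsScenario : ∀ {n} → Data n → Scenario → Set
IsScenario {n} D s = ∀ i → i ℕ.≤ n → (Data.w⁻ D i ≤ s i) × (s i ≤ Data.w⁺ D i)

sumFrom : (ℕ → ℚ) → ℕ → ℕ → ℚ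
sumFrom f a zero    = 0ℚ
sumFrom f a (suc c) = f a + sumFrom f (suc a) c

-- maxFrom f a c = max {f a, ..., f (a+c-1)}, and 0 if c = 0 (empty maximum is 0;
-- all terms used below are positive, so the extra 0 never changes a nonempty max).
maxFrom : (ℕ → ℚ) → ℕ → ℕ → ℚ
maxFrom f a zero    = 0ℚ
maxFrom f a (suc c) = f a ⊔ maxFrom f (suc a) c

maxFin : ∀ k → (Fin k → ℚ) → ℚ
maxFin zero    f = 0ℚ
maxFin (suc k) f = f zero ⊔ maxFin k (λ i → f (suc i))

-- A subpath {x_l,...,x_r} with sink x_t, l ≤ t ≤ r.
record Part : Set where
  constructor part
  field
    l t r : ℕ
    l≤t   : l ℕ.≤ t
    t≤r   : t ℕ.≤ r

-- A k-partition with sinks of P, with k = suc m: consecutive parts covering 0..n.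
record KPartition (n m : ℕ) : Set where
  field
    parts  : Fin (suc m) → Part
    first  : Part.l (parts zero) ≡ 0
    last   : Part.r (parts (fromℕ m)) ≡ n
    consec : ∀ (i : Fin m) → Part.l (parts (suc i)) ≡ suc (Part.r (parts (inject₁ i)))

module _ {n : ℕ} (D : Data n) where
  open Data D

  -- Θ_L(Q,y,s) = max_{l ≤ i < t} { (x_t - x_i) τ + Σ_{j=l}^{i} w_j(s) }
  ΘL : Part → Scenario → ℚ
  ΘL (part l t r _ _) s =
    maxFrom (λ i → (x t - x i) * τ + sumFrom s l (suc i ∸ l)) l (t ∸ l)

  -- Θ_R(Q,y,s) = max_{t < i ≤ r} { (x_i - x_t) τ + Σ_{j=i}^{r} w_j(s) }
  ΘR : Part → Scenario → ℚ
  ΘR (part l t r _ _) s =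
    maxFrom (λ i → (x i - x t) * τ + sumFrom s i (suc r ∸ i)) (suc t) (r ∸ t)

  Θ1 : Part → Scenario → ℚ
  Θ1 Q s = ΘL Q s ⊔ ΘR Q s

  Θk : ∀ {m} → KPartition n m → Scenario → ℚ
  Θk {m} P s = maxFin (suc m) (λ i → Θ1 (KPartition.parts P i) s)

  IsOpt : ℕ → Scenario → ℚ → Set
  IsOpt m s v = (Σ (KPartition n m) λ Q → Θk Q s ≡ v)
              × (∀ (Q : KPartition n m) → v ≤ Θk Q s)

  IsRegret : ∀ {m} → KPartition n m → Scenario → ℚ → Set
  IsRegret {m} P s ρ = Σ ℚ λ v → IsOpt m s v × (ρ ≡ Θk P s - v)

  IsWorstCase : ∀ {m} → KPartition n m → Scenario → Set
  IsWorstCase P s* =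
    IsScenario D s* ×
    Σ ℚ λ ρ* → IsRegret P s* ρ* ×
      (∀ s → IsScenario D s → ∀ ρ → IsRegret P s ρ → ρ ≤ ρ*)

  IsDominant : ∀ {m} → KPartition n m → Scenario → Fin (suc m) → Set
  IsDominant P s d =
    (∀ i → Θ1 (KPartition.parts P i) s ≤ Θ1 (KPartition.parts P d) s) ×
    (∀ i → i Fin.< d → Θ1 (KPartition.parts P i) s < Θ1 (KPartition.parts P d) s)

  LeftDominant : Scenario → ℕ → ℕ → Set
  LeftDominant s l r = Σ ℕ λ i → (l ℕ.≤ i) × (i ℕ.≤ r) ×
    (∀ j → l ℕ.≤ j → j ℕ.< i → s j ≡ w⁺ j) ×
    (∀ j → i ℕ.≤ j → j ℕ.≤ r → s j ≡ w⁻ j)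

  RightDominant : Scenario → ℕ → ℕ → Set
  RightDominant s l r = Σ ℕ λ i → (l ℕ.≤ i) × (i ℕ.≤ r) ×
    (∀ j → l ℕ.≤ j → j ℕ.< i → s j ≡ w⁻ j) ×
    (∀ j → i ℕ.≤ j → j ℕ.≤ r → s j ≡ w⁺ j)

{-# OPTIONS --safe #-}
-- The weights of a scenario s enter Θ¹ only through sums over windows of consecutive
-- vertices. Let P_d be the dominant part under s; the maximum defining Θ¹(P_d, s) is
-- attained by a term whose window W is an end segment of P_d: a prefix for a term of
-- Θ_L, a suffix for a term of Θ_R (W = ∅ if the maximum is 0). Setting the weights to
-- w⁺ on W and to w⁻ everywhere else adds exactly Δ = Σ_W (w⁺ − s) to that term and at
-- most Δ to every window sum, hence to Θ¹ of every part and Θ^k of every partition.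
-- So Θ^k(P̂, ·) grows by at least Δ and Θ^k_opt by at most Δ: the regret does not
-- decrease, and d stays dominant. Hence the regret of every scenario is at most that of
-- one of the finitely many raised scenarios; the raised scenario of largest regret is a
-- worst case, and raising it once more yields a worst case of the required shape.

module Submission where

open import Defs
open import Data.Nat using (ℕ; _≤_; _<_; suc)
open import Data.Fin using (Fin)
open import Data.Product using (Σ; _×_; _,_; proj₁; proj₂)
open import Data.Sum using (_⊎_; inj₁; inj₂)
open import Relation.Binary.PropositionalEquality using (_≡_; refl; sym; trans; cong; cong₂; subst)

open import Data.Nat as ℕ using (zero; _∸_; s≤s)
import Data.Nat.Properties as ℕₚ
open import Data.Fin as Fin using (zero; suc; fromℕ; inject₁)
import Data.Fin.Properties as Finₚ
open import Data.Rational as ℚ using (ℚ; 0ℚ; _+_; _-_; _*_; _⊔_; -_)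
import Data.Rational.Properties as ℚₚ
open import Data.Rational.Solver using (module +-*-Solver)
open import Data.List using (List; []; _∷_; map; concatMap; filter; upTo; cartesianProduct)
open import Data.List.Membership.Propositional using (_∈_; lose)
open import Data.List.Membership.Propositional.Properties
  using (∈-map⁺; ∈-concatMap⁺; ∈-upTo⁺; ∈-filter⁺; ∈-filter⁻; ∈-cartesianProduct⁺)
import Data.List.Relation.Unary.All as All
open import Data.List.Relation.Unary.Any using (here)
import Data.Vec.Functional as Vector
open Vector using (Vector)
open import Function using (_∘_)
open import Relation.Binary.Bundles using (DecTotalOrder)
open import Relation.Nullary using (¬_; Dec; yes; no; contradiction)
open import Relation.Nullary.Decidable using (_×-dec_)

open ℚₚ.≤-Reasoning hiding (start)
open import Data.List.Extrema (DecTotalOrder.totalOrder ℚₚ.≤-decTotalOrder)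
  using (argmin; argmax; argmin-all; f[argmin]≤f[xs]; f[xs]≤f[argmax])

+-nonneg : ∀ {p q} → 0ℚ ℚ.≤ p → 0ℚ ℚ.≤ q → 0ℚ ℚ.≤ p + q
+-nonneg {p} {q} p≥0 q≥0 = begin
  0ℚ       ≡⟨ sym (ℚₚ.+-identityʳ 0ℚ) ⟩
  0ℚ + 0ℚ  ≤⟨ ℚₚ.+-mono-≤ p≥0 q≥0 ⟩
  p + q    ∎

p≤p+q : ∀ p {q} → 0ℚ ℚ.≤ q → p ℚ.≤ p + q
p≤p+q p {q} q≥0 = begin
  p       ≡⟨ sym (ℚₚ.+-identityʳ p) ⟩
  p + 0ℚ  ≤⟨ ℚₚ.+-monoʳ-≤ p q≥0 ⟩
  p + q   ∎

p≤q+p : ∀ p {q} → 0ℚ ℚ.≤ q → p ℚ.≤ q + p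
p≤q+p p {q} q≥0 = begin
  p       ≡⟨ sym (ℚₚ.+-identityˡ p) ⟩
  0ℚ + p  ≤⟨ ℚₚ.+-monoˡ-≤ p q≥0 ⟩
  q + p   ∎

p≤q⇒0≤q-p : ∀ {p q} → p ℚ.≤ q → 0ℚ ℚ.≤ q - p
p≤q⇒0≤q-p {p} {q} p≤q = begin
  0ℚ     ≡⟨ sym (ℚₚ.+-inverseʳ p) ⟩
  p - p  ≤⟨ ℚₚ.+-monoˡ-≤ (- p) p≤q ⟩
  q - p  ∎

+-shift : ∀ p {q q′ Δ} → q′ ℚ.≤ q + Δ → p + q′ ℚ.≤ (p + q) + Δ
+-shift p {q} {q′} {Δ} q′≤q+Δ = begin
  p + q′        ≤⟨ ℚₚ.+-monoʳ-≤ p q′≤q+Δ ⟩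
  p + (q + Δ)   ≡⟨ sym (ℚₚ.+-assoc p q Δ) ⟩
  (p + q) + Δ   ∎

⊔-shift : ∀ p q {p′ q′ Δ} → p′ ℚ.≤ p + Δ → q′ ℚ.≤ q + Δ → p′ ⊔ q′ ℚ.≤ (p ⊔ q) + Δ
⊔-shift p q {Δ = Δ} p′≤ q′≤ = ℚₚ.⊔-lub
  (ℚₚ.≤-trans p′≤ (ℚₚ.+-monoˡ-≤ Δ (ℚₚ.p≤p⊔q p q)))
  (ℚₚ.≤-trans q′≤ (ℚₚ.+-monoˡ-≤ Δ (ℚₚ.p≤q⊔p p q)))

p+[q-p]≡q : ∀ p q → p + (q - p) ≡ q
p+[q-p]≡q = solve 2 (λ p q → p :+ (q :- p) := q) refl
  where open +-*-Solver

-‿shift : ∀ {p p′ q q′ Δ} → p + Δ ℚ.≤ p′ → q′ ℚ.≤ q + Δ → p - q ℚ.≤ p′ - q′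
-‿shift {p} {p′} {q} {q′} {Δ} p+Δ≤p′ q′≤q+Δ = begin
  p - q                ≡⟨ cancel p q Δ ⟩
  (p + Δ) - (q + Δ)    ≤⟨ ℚₚ.+-mono-≤ p+Δ≤p′ (ℚₚ.neg-antimono-≤ q′≤q+Δ) ⟩
  p′ - q′              ∎
  where
  open +-*-Solver
  cancel : ∀ p q Δ → p - q ≡ (p + Δ) - (q + Δ)
  cancel = solve 3 (λ p q Δ → p :- q := (p :+ Δ) :- (q :+ Δ)) refl

-- Sums and maxima over ranges of indices

InRange : ℕ → ℕ → ℕ → Set
InRange a c j = a ≤ j × j < a ℕ.+ c

inRange? : ∀ a c j → Dec (InRange a c j)
inRange? a c j = (a ℕ.≤? j) ×-dec (j ℕ.<? a ℕ.+ c)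

inRange-head : ∀ a c → InRange a (suc c) a
inRange-head a c = ℕₚ.≤-refl , ℕₚ.m<m+n a ℕ.z<s

inRange-suc : ∀ {a c j} → InRange (suc a) c j → InRange a (suc c) j
inRange-suc {a} {c} {j} (a<j , j<) = ℕₚ.<⇒≤ a<j , subst (j <_) (sym (ℕₚ.+-suc a c)) j<

inRange-cases : ∀ {a c j} → InRange a (suc c) j → a ≡ j ⊎ InRange (suc a) c j
inRange-cases {a} {c} {j} (a≤j , j<) with ℕₚ.m≤n⇒m<n∨m≡n a≤j
... | inj₂ a≡j = inj₁ a≡j
... | inj₁ a<j = inj₂ (a<j , subst (j <_) (ℕₚ.+-suc a c) j<)

inRange-∸ : ∀ {a b j} → a ≤ b → InRange a (b ∸ a) j → j < b
inRange-∸ {j = j} a≤b (_ , j<) = subst (j <_) (ℕₚ.m+[n∸m]≡n a≤b) j<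

sumFrom-split : ∀ f a p q → sumFrom f a (p ℕ.+ q) ≡ sumFrom f a p + sumFrom f (a ℕ.+ p) q
sumFrom-split f a zero    q rewrite ℕₚ.+-identityʳ a = sym (ℚₚ.+-identityˡ _)
sumFrom-split f a (suc p) q rewrite sumFrom-split f (suc a) p q | ℕₚ.+-suc a p =
  sym (ℚₚ.+-assoc (f a) _ _)

sumFrom-+ : ∀ f g a c → sumFrom (λ j → f j + g j) a c ≡ sumFrom f a c + sumFrom g a c
sumFrom-+ f g a zero    = sym (ℚₚ.+-identityʳ 0ℚ)
sumFrom-+ f g a (suc c) = begin-equality
  (f a + g a) + sumFrom (λ j → f j + g j) (suc a) c
    ≡⟨ cong ((f a + g a) +_) (sumFrom-+ f g (suc a) c) ⟩
  (f a + g a) + (sumFrom f (suc a) c + sumFrom g (suc a) c)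
    ≡⟨ swap (f a) (g a) _ _ ⟩
  (f a + sumFrom f (suc a) c) + (g a + sumFrom g (suc a) c)
    ∎
  where
  open +-*-Solver
  swap : ∀ p q r s → (p + q) + (r + s) ≡ (p + r) + (q + s)
  swap = solve 4 (λ p q r s → (p :+ q) :+ (r :+ s) := (p :+ r) :+ (q :+ s)) refl

sumFrom-cong : ∀ {f g} a c → (∀ j → InRange a c j → f j ≡ g j) → sumFrom f a c ≡ sumFrom g a c
sumFrom-cong a zero    f≡g = refl
sumFrom-cong a (suc c) f≡g =
  cong₂ _+_ (f≡g a (inRange-head a c)) (sumFrom-cong (suc a) c (λ j → f≡g j ∘ inRange-suc))

sumFrom-mono-≤ : ∀ {f g} a c → (∀ j → InRange a c j → f j ℚ.≤ g j) → sumFrom f a c ℚ.≤ sumFrom g a c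
sumFrom-mono-≤ a zero    f≤g = ℚₚ.≤-refl
sumFrom-mono-≤ a (suc c) f≤g =
  ℚₚ.+-mono-≤ (f≤g a (inRange-head a c)) (sumFrom-mono-≤ (suc a) c (λ j → f≤g j ∘ inRange-suc))

sumFrom-zero : ∀ {f} a c → (∀ j → InRange a c j → f j ≡ 0ℚ) → sumFrom f a c ≡ 0ℚ
sumFrom-zero {f} a c f≡0 = trans (sumFrom-cong a c f≡0) (zeros a c)
  where
  zeros : ∀ a c → sumFrom (λ _ → 0ℚ) a c ≡ 0ℚ
  zeros a zero    = refl
  zeros a (suc c) = trans (cong (0ℚ +_) (zeros (suc a) c)) (ℚₚ.+-identityʳ 0ℚ)

sumFrom-nonneg : ∀ {f} → (∀ j → 0ℚ ℚ.≤ f j) → ∀ a c → 0ℚ ℚ.≤ sumFrom f a c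
sumFrom-nonneg f≥0 a zero    = ℚₚ.≤-refl
sumFrom-nonneg f≥0 a (suc c) = +-nonneg (f≥0 a) (sumFrom-nonneg f≥0 (suc a) c)

module _ {f : ℕ → ℚ} (f≥0 : ∀ j → 0ℚ ℚ.≤ f j) where

  sumFrom-prefix-≤ : ∀ a p q → sumFrom f a p ℚ.≤ sumFrom f a (p ℕ.+ q)
  sumFrom-prefix-≤ a p q = begin
    sumFrom f a p                             ≤⟨ p≤p+q _ (sumFrom-nonneg f≥0 (a ℕ.+ p) q) ⟩
    sumFrom f a p + sumFrom f (a ℕ.+ p) q     ≡⟨ sumFrom-split f a p q ⟨
    sumFrom f a (p ℕ.+ q)                     ∎

  sumFrom-suffix-≤ : ∀ a p q → sumFrom f (a ℕ.+ p) q ℚ.≤ sumFrom f a (p ℕ.+ q)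
  sumFrom-suffix-≤ a p q = begin
    sumFrom f (a ℕ.+ p) q                     ≤⟨ p≤q+p _ (sumFrom-nonneg f≥0 a p) ⟩
    sumFrom f a p + sumFrom f (a ℕ.+ p) q     ≡⟨ sumFrom-split f a p q ⟨
    sumFrom f a (p ℕ.+ q)                     ∎

  sumFrom-≤-support : ∀ {a L} → (∀ j → ¬ InRange a L j → f j ≡ 0ℚ) →
                      ∀ c len → sumFrom f c len ℚ.≤ sumFrom f a L
  sumFrom-≤-support {a} {L} outside≡0 c len = begin
    sumFrom f c len                                   ≤⟨ sumFrom-suffix-≤ 0 c len ⟩
    sumFrom f 0 (c ℕ.+ len)                           ≤⟨ sumFrom-prefix-≤ 0 (c ℕ.+ len) (a ℕ.+ L) ⟩
    sumFrom f 0 (c ℕ.+ len ℕ.+ (a ℕ.+ L))             ≡⟨ cong (sumFrom f 0) (ℕₚ.+-comm (c ℕ.+ len) (a ℕ.+ L)) ⟩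
    sumFrom f 0 (a ℕ.+ L ℕ.+ (c ℕ.+ len))             ≡⟨ sumFrom-split f 0 (a ℕ.+ L) (c ℕ.+ len) ⟩
    sumFrom f 0 (a ℕ.+ L) + sumFrom f (a ℕ.+ L) (c ℕ.+ len)
      ≡⟨ cong₂ _+_ (sumFrom-split f 0 a L) (sumFrom-zero (a ℕ.+ L) (c ℕ.+ len) after) ⟩
    (sumFrom f 0 a + sumFrom f a L) + 0ℚ              ≡⟨ ℚₚ.+-identityʳ _ ⟩
    sumFrom f 0 a + sumFrom f a L                     ≡⟨ cong (_+ sumFrom f a L) (sumFrom-zero 0 a before) ⟩
    0ℚ + sumFrom f a L                                ≡⟨ ℚₚ.+-identityˡ _ ⟩
    sumFrom f a L                                     ∎
    where
    before : ∀ j → InRange 0 a j → f j ≡ 0ℚ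
    before j (_ , j<a) = outside≡0 j (λ (a≤j , _) → ℕₚ.<⇒≱ j<a a≤j)
    after : ∀ j → InRange (a ℕ.+ L) (c ℕ.+ len) j → f j ≡ 0ℚ
    after j (a+L≤j , _) = outside≡0 j (λ (_ , j<a+L) → ℕₚ.<⇒≱ j<a+L a+L≤j)

maxFrom-ub : ∀ f a c {j} → InRange a c j → f j ℚ.≤ maxFrom f a c
maxFrom-ub f a zero    (a≤j , j<a+0) = contradiction (subst (_ <_) (ℕₚ.+-identityʳ a) j<a+0) (ℕₚ.≤⇒≯ a≤j)
maxFrom-ub f a (suc c) j∈ with inRange-cases j∈
... | inj₁ refl = ℚₚ.p≤p⊔q (f a) _
... | inj₂ j∈′  = ℚₚ.p≤q⇒p≤r⊔q (f a) (maxFrom-ub f (suc a) c j∈′)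

maxFrom-lub : ∀ {f B} → 0ℚ ℚ.≤ B → ∀ a c → (∀ j → InRange a c j → f j ℚ.≤ B) → maxFrom f a c ℚ.≤ B
maxFrom-lub B≥0 a zero    f≤B = B≥0
maxFrom-lub B≥0 a (suc c) f≤B =
  ℚₚ.⊔-lub (f≤B a (inRange-head a c)) (maxFrom-lub B≥0 (suc a) c (λ j → f≤B j ∘ inRange-suc))

maxFrom-nonneg : ∀ f a c → 0ℚ ℚ.≤ maxFrom f a c
maxFrom-nonneg f a zero    = ℚₚ.≤-refl
maxFrom-nonneg f a (suc c) = ℚₚ.p≤q⇒p≤r⊔q (f a) (maxFrom-nonneg f (suc a) c)

maxFrom-attained : ∀ f a c → maxFrom f a c ≡ 0ℚ ⊎ Σ ℕ λ j → InRange a c j × maxFrom f a c ≡ f j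
maxFrom-attained f a zero = inj₁ refl
maxFrom-attained f a (suc c) with ℚₚ.⊔-sel (f a) (maxFrom f (suc a) c)
... | inj₁ max≡fa = inj₂ (a , inRange-head a c , max≡fa)
... | inj₂ max≡rest with maxFrom-attained f (suc a) c
...   | inj₁ rest≡0            = inj₁ (trans max≡rest rest≡0)
...   | inj₂ (j , j∈ , rest≡fj) = inj₂ (j , inRange-suc j∈ , trans max≡rest rest≡fj)

maxFrom-shift : ∀ {f f′ Δ} → 0ℚ ℚ.≤ Δ → ∀ a c → (∀ j → InRange a c j → f′ j ℚ.≤ f j + Δ) →
                maxFrom f′ a c ℚ.≤ maxFrom f a c + Δ
maxFrom-shift {f} {f′} {Δ} Δ≥0 a c f′≤ = maxFrom-lub (+-nonneg (maxFrom-nonneg f a c) Δ≥0) a c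
  (λ j j∈ → ℚₚ.≤-trans (f′≤ j j∈) (ℚₚ.+-monoˡ-≤ Δ (maxFrom-ub f a c j∈)))

maxFin-ub : ∀ k f (i : Fin k) → f i ℚ.≤ maxFin k f
maxFin-ub (suc k) f zero    = ℚₚ.p≤p⊔q (f zero) _
maxFin-ub (suc k) f (suc i) = ℚₚ.p≤q⇒p≤r⊔q (f zero) (maxFin-ub k (f ∘ suc) i)

maxFin-lub : ∀ k f {B} → 0ℚ ℚ.≤ B → (∀ i → f i ℚ.≤ B) → maxFin k f ℚ.≤ B
maxFin-lub zero    f B≥0 f≤B = B≥0
maxFin-lub (suc k) f B≥0 f≤B = ℚₚ.⊔-lub (f≤B zero) (maxFin-lub k (f ∘ suc) B≥0 (f≤B ∘ suc))

maxFin-nonneg : ∀ k f → 0ℚ ℚ.≤ maxFin k f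
maxFin-nonneg zero    f = ℚₚ.≤-refl
maxFin-nonneg (suc k) f = ℚₚ.p≤q⇒p≤r⊔q (f zero) (maxFin-nonneg k (f ∘ suc))

maxFin-cong : ∀ k {f g} → (∀ i → f i ≡ g i) → maxFin k f ≡ maxFin k g
maxFin-cong zero    f≡g = refl
maxFin-cong (suc k) f≡g = cong₂ _⊔_ (f≡g zero) (maxFin-cong k (f≡g ∘ suc))

maxFin-shift : ∀ k {f f′ Δ} → 0ℚ ℚ.≤ Δ → (∀ i → f′ i ℚ.≤ f i + Δ) → maxFin k f′ ℚ.≤ maxFin k f + Δ
maxFin-shift k {f} {f′} {Δ} Δ≥0 f′≤ = maxFin-lub k f′ (+-nonneg (maxFin-nonneg k f) Δ≥0)
  (λ i → ℚₚ.≤-trans (f′≤ i) (ℚₚ.+-monoˡ-≤ Δ (maxFin-ub k f i)))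

IsFirstArgmax : ∀ {k} → (Fin k → ℚ) → Fin k → Set
IsFirstArgmax f d = (∀ i → f i ℚ.≤ f d) × (∀ i → i Fin.< d → f i ℚ.< f d)

firstArgmax : ∀ m (f : Fin (suc m) → ℚ) → Σ (Fin (suc m)) (IsFirstArgmax f)
firstArgmax zero    f = zero , (λ { zero → ℚₚ.≤-refl }) , (λ _ ())
firstArgmax (suc m) f with firstArgmax m (f ∘ suc)
... | d , d-max , d-first with f (suc d) ℚₚ.≤? f zero
...   | yes fd≤f0 = zero , (λ { zero → ℚₚ.≤-refl ; (suc i) → ℚₚ.≤-trans (d-max i) fd≤f0 }) , (λ _ ())
...   | no  fd≰f0 = suc d , (λ { zero → ℚₚ.<⇒≤ f0<fd ; (suc i) → d-max i }) ,
                            (λ { zero _ → f0<fd ; (suc i) (s≤s i<d) → d-first i i<d })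
  where
  f0<fd = ℚₚ.≰⇒> fd≰f0

firstArgmax-shift : ∀ {k} {f f′ : Fin k → ℚ} {d Δ} → IsFirstArgmax f d →
                    (∀ i → f′ i ℚ.≤ f i + Δ) → f d + Δ ℚ.≤ f′ d → IsFirstArgmax f′ d
firstArgmax-shift {Δ = Δ} (d-max , d-first) f′≤ lift =
  (λ i → ℚₚ.≤-trans (f′≤ i) (ℚₚ.≤-trans (ℚₚ.+-monoˡ-≤ Δ (d-max i)) lift)) ,
  (λ i i<d → ℚₚ.≤-<-trans (f′≤ i) (ℚₚ.<-≤-trans (ℚₚ.+-monoˡ-< Δ (d-first i i<d)) lift))

-- Parts and k-partitions

stepwise-≤-last : ∀ m (g : Fin (suc m) → ℕ) → (∀ i → g (inject₁ i) ≤ g (suc i)) → ∀ j → g j ≤ g (fromℕ m)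
stepwise-≤-last zero    g g≤ zero    = ℕₚ.≤-refl
stepwise-≤-last (suc m) g g≤ zero    = ℕₚ.≤-trans (g≤ zero) (stepwise-≤-last m (g ∘ suc) (g≤ ∘ suc) zero)
stepwise-≤-last (suc m) g g≤ (suc j) = stepwise-≤-last m (g ∘ suc) (g≤ ∘ suc) j

Part-l≤r : ∀ Q → Part.l Q ≤ Part.r Q
Part-l≤r Q = ℕₚ.≤-trans (Part.l≤t Q) (Part.t≤r Q)

KPartition-r≤n : ∀ {n m} (P : KPartition n m) i → Part.r (KPartition.parts P i) ≤ n
KPartition-r≤n {m = m} P i = subst (Part.r (parts i) ≤_) last (stepwise-≤-last m (Part.r ∘ parts) r-step i)
  where
  open KPartition P
  r-step : ∀ i → Part.r (parts (inject₁ i)) ≤ Part.r (parts (suc i))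
  r-step i = ℕₚ.≤-trans (ℕₚ.n≤1+n _) (subst (_≤ Part.r (parts (suc i))) (consec i) (Part-l≤r (parts (suc i))))

partIfValid : ℕ → ℕ → ℕ → List Part
partIfValid l t r with l ℕ.≤? t | t ℕ.≤? r
... | yes l≤t | yes t≤r = part l t r l≤t t≤r ∷ []
... | _       | _       = []

∈-partIfValid : ∀ {l t r} (l≤t : l ≤ t) (t≤r : t ≤ r) → part l t r l≤t t≤r ∈ partIfValid l t r
∈-partIfValid {l} {t} {r} l≤t t≤r with l ℕ.≤? t | t ℕ.≤? r
... | yes l≤t′ | yes t≤r′ = here (cong₂ (part l t r) (ℕₚ.≤-irrelevant l≤t l≤t′) (ℕₚ.≤-irrelevant t≤r t≤r′))
... | no  l≰t  | _        = contradiction l≤t l≰t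
... | yes _    | no  t≰r  = contradiction t≤r t≰r

partsWithin : ℕ → List Part
partsWithin n = concatMap (λ l → concatMap (λ t → concatMap (partIfValid l t) (upTo (suc n))) (upTo (suc n))) (upTo (suc n))

∈-partsWithin : ∀ {n} (Q : Part) → Part.r Q ≤ n → Q ∈ partsWithin n
∈-partsWithin {n} (part l t r l≤t t≤r) r≤n =
  ∈-concatMap⁺ partsFrom (lose (∈-upTo⁺ (s≤s l≤n))
    (∈-concatMap⁺ (partsFromTo l) (lose (∈-upTo⁺ (s≤s t≤n))
      (∈-concatMap⁺ (partIfValid l t) (lose (∈-upTo⁺ (s≤s r≤n)) (∈-partIfValid l≤t t≤r))))))
  where
  partsFromTo : ℕ → ℕ → List Part
  partsFromTo l t = concatMap (partIfValid l t) (upTo (suc n))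
  partsFrom : ℕ → List Part
  partsFrom l = concatMap (partsFromTo l) (upTo (suc n))
  t≤n = ℕₚ.≤-trans t≤r r≤n
  l≤n = ℕₚ.≤-trans l≤t t≤n

vectors : ∀ {A : Set} → List A → ∀ k → List (Vector A k)
vectors xs zero    = Vector.[] ∷ []
vectors xs (suc k) = concatMap (λ x → map (x Vector.∷_) (vectors xs k)) xs

∈-vectors : ∀ {A : Set} {xs : List A} k (f : Vector A k) → (∀ i → f i ∈ xs) →
            Σ (Vector A k) λ g → g ∈ vectors xs k × (∀ i → g i ≡ f i)
∈-vectors zero    f f∈ = Vector.[] , here refl , λ ()
∈-vectors (suc k) f f∈ with ∈-vectors k (f ∘ suc) (f∈ ∘ suc)
... | g , g∈ , g≗ = f zero Vector.∷ g , ∈-concatMap⁺ _ (lose (f∈ zero) (∈-map⁺ (f zero Vector.∷_) g∈)) ,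
                    λ { zero → refl ; (suc i) → g≗ i }

IsKPartition : ∀ n m → Vector Part (suc m) → Set
IsKPartition n m f = (Part.l (f zero) ≡ 0) × (Part.r (f (fromℕ m)) ≡ n) ×
                     (∀ i → Part.l (f (suc i)) ≡ suc (Part.r (f (inject₁ i))))

isKPartition? : ∀ n m f → Dec (IsKPartition n m f)
isKPartition? n m f = (Part.l (f zero) ℕ.≟ 0) ×-dec (Part.r (f (fromℕ m)) ℕ.≟ n) ×-dec
                      Finₚ.all? (λ i → Part.l (f (suc i)) ℕ.≟ suc (Part.r (f (inject₁ i))))

toKPartition : ∀ {n m f} → IsKPartition n m f → KPartition n m
toKPartition {f = f} (first , last , consec) =
  record { parts = f ; first = first ; last = last ; consec = consec }

isKPartition-parts : ∀ {n m} (Q : KPartition n m) → IsKPartition n m (KPartition.parts Q)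
isKPartition-parts Q = KPartition.first Q , KPartition.last Q , KPartition.consec Q

isKPartition-resp : ∀ {n m f g} → (∀ i → f i ≡ g i) → IsKPartition n m g → IsKPartition n m f
isKPartition-resp {m = m} f≗g (first , last , consec) =
  trans (cong Part.l (f≗g zero)) first ,
  trans (cong Part.r (f≗g (fromℕ m))) last ,
  λ i → trans (cong Part.l (f≗g (suc i))) (trans (consec i) (cong (suc ∘ Part.r) (sym (f≗g (inject₁ i)))))

-- Raising the weights on an end segment

-- A prefix stops before the last vertex of Q: LeftDominant needs its switch index to be ≤ r.
data EndSegment (Q : Part) : ℕ → ℕ → Set where
  prefix : ∀ {L} → Part.l Q ℕ.+ L ≤ Part.r Q → EndSegment Q (Part.l Q) L
  suffix : ∀ {a L} → Part.l Q ≤ a → a ≤ Part.r Q → a ℕ.+ L ≡ suc (Part.r Q) → EndSegment Q a L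

endSegment-bounds : ∀ {Q a L} → EndSegment Q a L → Part.l Q ≤ a × a ℕ.+ L ≤ suc (Part.r Q)
endSegment-bounds (prefix l+L≤r)      = ℕₚ.≤-refl , ℕₚ.m≤n⇒m≤1+n l+L≤r
endSegment-bounds (suffix l≤a _ a+L≡) = l≤a , ℕₚ.≤-reflexive a+L≡

endSegment-within : ∀ {n Q a L} → EndSegment Q a L → Part.r Q ≤ n → a ℕ.+ L ≤ suc n
endSegment-within seg r≤n = ℕₚ.≤-trans (proj₂ (endSegment-bounds seg)) (s≤s r≤n)

module _ {n : ℕ} (D : Data n) where
  open Data D

  leftTerm : ℕ → ℕ → Scenario → ℕ → ℚ
  leftTerm l t σ i = (x t - x i) * τ + sumFrom σ l (suc i ∸ l)

  rightTerm : ℕ → ℕ → Scenario → ℕ → ℚ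
  rightTerm t r σ i = (x i - x t) * τ + sumFrom σ i (suc r ∸ i)

  Θ1-nonneg : ∀ Q s → 0ℚ ℚ.≤ Θ1 D Q s
  Θ1-nonneg (part l t r _ _) s = ℚₚ.p≤q⇒p≤q⊔r _ (maxFrom-nonneg (leftTerm l t s) l (t ∸ l))

  SumShift : Scenario → Scenario → ℚ → Set
  SumShift s′ s Δ = ∀ c len → c ℕ.+ len ≤ suc n → sumFrom s′ c len ℚ.≤ sumFrom s c len + Δ

  Θ1-shift : ∀ {s′ s Δ} → 0ℚ ℚ.≤ Δ → SumShift s′ s Δ → ∀ Q → Part.r Q ≤ n → Θ1 D Q s′ ℚ.≤ Θ1 D Q s + Δ
  Θ1-shift {s′} {s} Δ≥0 shift Q@(part l t r l≤t t≤r) r≤n = ⊔-shift (ΘL D Q s) (ΘR D Q s)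
    (maxFrom-shift {leftTerm l t s} {leftTerm l t s′} Δ≥0 l (t ∸ l)
      (λ i i∈ → +-shift ((x t - x i) * τ) (shift l (suc i ∸ l) (left-within i∈))))
    (maxFrom-shift {rightTerm t r s} {rightTerm t r s′} Δ≥0 (suc t) (r ∸ t)
      (λ i i∈ → +-shift ((x i - x t) * τ) (shift i (suc r ∸ i) (right-within i∈))))
    where
    left-within : ∀ {i} → InRange l (t ∸ l) i → l ℕ.+ (suc i ∸ l) ≤ suc n
    left-within {i} i∈ = subst (_≤ suc n) (sym (ℕₚ.m+[n∸m]≡n (ℕₚ.m≤n⇒m≤1+n (proj₁ i∈))))
      (ℕₚ.≤-trans (inRange-∸ l≤t i∈) (ℕₚ.m≤n⇒m≤1+n (ℕₚ.≤-trans t≤r r≤n)))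
    right-within : ∀ {i} → InRange (suc t) (r ∸ t) i → i ℕ.+ (suc r ∸ i) ≤ suc n
    right-within i∈ = subst (_≤ suc n) (sym (ℕₚ.m+[n∸m]≡n (ℕₚ.<⇒≤ (inRange-∸ (s≤s t≤r) i∈)))) (s≤s r≤n)

  Θk-shift : ∀ {m s′ s Δ} → 0ℚ ℚ.≤ Δ → SumShift s′ s Δ → (Q : KPartition n m) → Θk D Q s′ ℚ.≤ Θk D Q s + Δ
  Θk-shift {m} {s′} {s} Δ≥0 shift Q = maxFin-shift (suc m) {Θ1′ s} {Θ1′ s′} Δ≥0
    (λ i → Θ1-shift Δ≥0 shift (KPartition.parts Q i) (KPartition-r≤n Q i))
    where
    Θ1′ : Scenario → Fin (suc m) → ℚ
    Θ1′ σ i = Θ1 D (KPartition.parts Q i) σ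

  record CriticalTerm (Q : Part) (s : Scenario) : Set where
    field
      offset  : ℚ
      start   : ℕ
      length  : ℕ
      segment : EndSegment Q start length
      term-≤  : ∀ σ → offset + sumFrom σ start length ℚ.≤ Θ1 D Q σ
      ≤-term  : Θ1 D Q s ℚ.≤ offset + sumFrom s start length

  emptyTerm : ∀ {Q s} → Θ1 D Q s ≡ 0ℚ → CriticalTerm Q s
  emptyTerm {Q} {s} Θ1≡0 = record
    { offset  = 0ℚ
    ; start   = Part.l Q
    ; length  = 0
    ; segment = prefix (subst (_≤ Part.r Q) (sym (ℕₚ.+-identityʳ (Part.l Q))) (Part-l≤r Q))
    ; term-≤  = λ σ → ℚₚ.≤-trans (ℚₚ.≤-reflexive (ℚₚ.+-identityʳ 0ℚ)) (Θ1-nonneg Q σ)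
    ; ≤-term  = ℚₚ.≤-reflexive (trans Θ1≡0 (sym (ℚₚ.+-identityʳ 0ℚ)))
    }

  criticalTerm : ∀ Q s → CriticalTerm Q s
  criticalTerm Q@(part l t r l≤t t≤r) s with ℚₚ.⊔-sel (ΘL D Q s) (ΘR D Q s)
  ... | inj₁ Θ1≡ΘL with maxFrom-attained (leftTerm l t s) l (t ∸ l)
  ...   | inj₁ ΘL≡0              = emptyTerm (trans Θ1≡ΘL ΘL≡0)
  ...   | inj₂ (i , i∈ , ΘL≡term) = record
    { offset  = (x t - x i) * τ
    ; start   = l
    ; length  = suc i ∸ l
    ; segment = prefix (subst (_≤ r) (sym (ℕₚ.m+[n∸m]≡n (ℕₚ.m≤n⇒m≤1+n (proj₁ i∈))))
                                     (ℕₚ.≤-trans (inRange-∸ l≤t i∈) t≤r))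
    ; term-≤  = λ σ → ℚₚ.p≤q⇒p≤q⊔r _ (maxFrom-ub (leftTerm l t σ) l (t ∸ l) i∈)
    ; ≤-term  = ℚₚ.≤-reflexive (trans Θ1≡ΘL ΘL≡term)
    }
  criticalTerm Q@(part l t r l≤t t≤r) s | inj₂ Θ1≡ΘR with maxFrom-attained (rightTerm t r s) (suc t) (r ∸ t)
  ...   | inj₁ ΘR≡0              = emptyTerm (trans Θ1≡ΘR ΘR≡0)
  ...   | inj₂ (i , i∈ , ΘR≡term) = record
    { offset  = (x i - x t) * τ
    ; start   = i
    ; length  = suc r ∸ i
    ; segment = suffix (ℕₚ.≤-trans l≤t (ℕₚ.<⇒≤ (proj₁ i∈))) (ℕₚ.≤-pred i<1+r) (ℕₚ.m+[n∸m]≡n (ℕₚ.<⇒≤ i<1+r))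
    ; term-≤  = λ σ → ℚₚ.p≤q⇒p≤r⊔q (ΘL D Q σ) (maxFrom-ub (rightTerm t r σ) (suc t) (r ∸ t) i∈)
    ; ≤-term  = ℚₚ.≤-reflexive (trans Θ1≡ΘR ΘR≡term)
    }
    where
    i<1+r : i < suc r
    i<1+r = inRange-∸ (s≤s t≤r) i∈

  raise : ℕ → ℕ → Scenario
  raise a L j with inRange? a L j
  ... | yes _ = w⁺ j
  ... | no  _ = w⁻ j

  raise-inside : ∀ a L {j} → InRange a L j → raise a L j ≡ w⁺ j
  raise-inside a L {j} j∈ with inRange? a L j
  ... | yes _  = refl
  ... | no  j∉ = contradiction j∈ j∉

  raise-outside : ∀ a L {j} → ¬ InRange a L j → raise a L j ≡ w⁻ j
  raise-outside a L {j} j∉ with inRange? a L j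
  ... | yes j∈ = contradiction j∈ j∉
  ... | no  _  = refl

  raise-isScenario : Valid D → ∀ a L → IsScenario D (raise a L)
  raise-isScenario V a L j j≤n with inRange? a L j
  ... | yes _ = Valid.w⁻≤w⁺ V j j≤n , ℚₚ.≤-refl
  ... | no  _ = ℚₚ.≤-refl , Valid.w⁻≤w⁺ V j j≤n

  IsConcentratedOn : Scenario → Part → Set
  IsConcentratedOn s Q =
    (∀ i → i ≤ n → (i < Part.l Q ⊎ Part.r Q < i) → s i ≡ w⁻ i) ×
    (LeftDominant D s (Part.l Q) (Part.r Q) ⊎ RightDominant D s (Part.l Q) (Part.r Q))

  raise-concentrated : ∀ {Q a L} → EndSegment Q a L → IsConcentratedOn (raise a L) Q
  raise-concentrated {Q} {a} {L} seg = outside , shape seg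
    where
    l≤a       = proj₁ (endSegment-bounds seg)
    a+L≤1+r   = proj₂ (endSegment-bounds seg)
    outside : ∀ i → i ≤ n → (i < Part.l Q ⊎ Part.r Q < i) → raise a L i ≡ w⁻ i
    outside i _ (inj₁ i<l) = raise-outside a L (λ (a≤i , _) → ℕₚ.<⇒≱ i<l (ℕₚ.≤-trans l≤a a≤i))
    outside i _ (inj₂ r<i) = raise-outside a L (λ (_ , i<a+L) → ℕₚ.<⇒≱ r<i (ℕₚ.≤-pred (ℕₚ.≤-trans i<a+L a+L≤1+r)))
    shape : ∀ {a L} → EndSegment Q a L →
            LeftDominant D (raise a L) (Part.l Q) (Part.r Q) ⊎ RightDominant D (raise a L) (Part.l Q) (Part.r Q)
    shape {L = L} (prefix l+L≤r) = inj₁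
      ( Part.l Q ℕ.+ L , ℕₚ.m≤m+n _ L , l+L≤r
      , (λ j l≤j j<l+L → raise-inside (Part.l Q) L (l≤j , j<l+L))
      , (λ j l+L≤j _ → raise-outside (Part.l Q) L (λ (_ , j<l+L) → ℕₚ.<⇒≱ j<l+L l+L≤j)) )
    shape {a} {L} (suffix l≤a a≤r a+L≡1+r) = inj₂
      ( a , l≤a , a≤r
      , (λ j _ j<a → raise-outside a L (λ (a≤j , _) → ℕₚ.<⇒≱ j<a a≤j))
      , (λ j a≤j j≤r → raise-inside a L (a≤j , subst (j <_) (sym a+L≡1+r) (s≤s j≤r))) )

  module Raising {s} (s∈𝒮 : IsScenario D s) {a L} (a+L≤ : a ℕ.+ L ≤ suc n) where

    gain : ℕ → ℚ
    gain j with inRange? a L j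
    ... | yes _ = w⁺ j - s j
    ... | no  _ = 0ℚ

    gain-nonneg : ∀ j → 0ℚ ℚ.≤ gain j
    gain-nonneg j with inRange? a L j
    ... | yes (_ , j<a+L) = p≤q⇒0≤q-p (proj₂ (s∈𝒮 j (ℕₚ.≤-pred (ℕₚ.≤-trans j<a+L a+L≤))))
    ... | no  _          = ℚₚ.≤-refl

    gain-outside : ∀ j → ¬ InRange a L j → gain j ≡ 0ℚ
    gain-outside j j∉ with inRange? a L j
    ... | yes j∈ = contradiction j∈ j∉
    ... | no  _  = refl

    raise≡s+gain : ∀ {j} → InRange a L j → raise a L j ≡ s j + gain j
    raise≡s+gain {j} j∈ with inRange? a L j
    ... | yes _  = sym (p+[q-p]≡q (s j) (w⁺ j))
    ... | no  j∉ = contradiction j∈ j∉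

    raise≤s+gain : ∀ j → j ≤ n → raise a L j ℚ.≤ s j + gain j
    raise≤s+gain j j≤n with inRange? a L j
    ... | yes _ = ℚₚ.≤-reflexive (sym (p+[q-p]≡q (s j) (w⁺ j)))
    ... | no  _ = ℚₚ.≤-trans (proj₁ (s∈𝒮 j j≤n)) (ℚₚ.≤-reflexive (sym (ℚₚ.+-identityʳ (s j))))

    Δ : ℚ
    Δ = sumFrom gain a L

    Δ-nonneg : 0ℚ ℚ.≤ Δ
    Δ-nonneg = sumFrom-nonneg gain-nonneg a L

    raise-sumShift : SumShift (raise a L) s Δ
    raise-sumShift c len c+len≤ = begin
      sumFrom (raise a L) c len
        ≤⟨ sumFrom-mono-≤ c len (λ j (_ , j<) → raise≤s+gain j (ℕₚ.≤-pred (ℕₚ.≤-trans j< c+len≤))) ⟩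
      sumFrom (λ j → s j + gain j) c len
        ≡⟨ sumFrom-+ s gain c len ⟩
      sumFrom s c len + sumFrom gain c len
        ≤⟨ ℚₚ.+-monoʳ-≤ (sumFrom s c len) (sumFrom-≤-support gain-nonneg gain-outside c len) ⟩
      sumFrom s c len + Δ
        ∎

    raise-sum-window : sumFrom (raise a L) a L ≡ sumFrom s a L + Δ
    raise-sum-window = trans (sumFrom-cong a L (λ _ → raise≡s+gain)) (sumFrom-+ s gain a L)

-- Optimal partitions and regret

-- P only supplies the default of argmin: the feasible list may a priori be empty.
module Optimum {n m} (D : Data n) (P : KPartition n m) where

  cost : Scenario → Vector Part (suc m) → ℚ
  cost s f = maxFin (suc m) (λ i → Θ1 D (f i) s)

  candidates : List (Vector Part (suc m))
  candidates = vectors (partsWithin n) (suc m)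

  feasible : List (Vector Part (suc m))
  feasible = filter (isKPartition? n m) candidates

  optimalParts : Scenario → Vector Part (suc m)
  optimalParts s = argmin (cost s) (KPartition.parts P) feasible

  optimalParts-feasible : ∀ s → IsKPartition n m (optimalParts s)
  optimalParts-feasible s = argmin-all (cost s) {P = IsKPartition n m} (isKPartition-parts P)
    (All.tabulate (λ f∈ → proj₂ (∈-filter⁻ (isKPartition? n m) {xs = candidates} f∈)))

  optimalParts-minimal : ∀ s {f} → f ∈ feasible → cost s (optimalParts s) ℚ.≤ cost s f
  optimalParts-minimal s = All.lookup (f[argmin]≤f[xs] {f = cost s} (KPartition.parts P) feasible)

  optimum : Scenario → KPartition n m
  optimum s = toKPartition {f = optimalParts s} (optimalParts-feasible s)

  optimum-minimal : ∀ s (Q : KPartition n m) → Θk D (optimum s) s ℚ.≤ Θk D Q s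
  optimum-minimal s Q = begin
    cost s (optimalParts s)  ≤⟨ optimalParts-minimal s (∈-filter⁺ (isKPartition? n m) f∈ f-feasible) ⟩
    cost s f                 ≡⟨ maxFin-cong (suc m) (λ i → cong (λ p → Θ1 D p s) (f≗ i)) ⟩
    Θk D Q s                 ∎
    where
    listed = ∈-vectors (suc m) (KPartition.parts Q)
               (λ i → ∈-partsWithin (KPartition.parts Q i) (KPartition-r≤n Q i))
    f  = proj₁ listed
    f∈ = proj₁ (proj₂ listed)
    f≗ = proj₂ (proj₂ listed)
    f-feasible = isKPartition-resp f≗ (isKPartition-parts Q)

module WorstCase {n m} (D : Data n) (V : Valid D) (P : KPartition n m) where
  open Optimum D P
  open KPartition P using (parts)

  Θopt : Scenario → ℚ
  Θopt s = Θk D (optimum s) s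

  -- Abstract so that conversion checking never unfolds the ℚ arithmetic inside Θk.
  abstract
    regret : Scenario → ℚ
    regret s = Θk D P s - Θopt s

    isRegret-regret : ∀ s → IsRegret D P s (regret s)
    isRegret-regret s = Θopt s , ((optimum s , refl) , optimum-minimal s) , refl

    isRegret⇒≡regret : ∀ {s ρ} → IsRegret D P s ρ → ρ ≡ regret s
    isRegret⇒≡regret {s} (v , ((Q , Θk≡v) , v-minimal) , refl) = cong (λ v → Θk D P s - v)
      (ℚₚ.≤-antisym (v-minimal (optimum s)) (ℚₚ.≤-trans (optimum-minimal s Q) (ℚₚ.≤-reflexive Θk≡v)))

    regret-shift : ∀ {s s′ Δ} → Θk D P s + Δ ℚ.≤ Θk D P s′ → Θopt s′ ℚ.≤ Θopt s + Δ → regret s ℚ.≤ regret s′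
    regret-shift {s} {s′} = -‿shift {Θk D P s} {Θk D P s′} {Θopt s} {Θopt s′}

  isWorstCase : ∀ {s*} → IsScenario D s* → (∀ s → IsScenario D s → regret s ℚ.≤ regret s*) → IsWorstCase D P s*
  isWorstCase {s*} s*∈𝒮 maximal = s*∈𝒮 , regret s* , isRegret-regret s* ,
    λ s s∈𝒮 ρ ρ-regret → ℚₚ.≤-trans (ℚₚ.≤-reflexive (isRegret⇒≡regret ρ-regret)) (maximal s s∈𝒮)

  raise-critical : ∀ {s d} → IsScenario D s → IsDominant D P s d → (c : CriticalTerm D (parts d) s) →
                   let s′ = raise D (CriticalTerm.start c) (CriticalTerm.length c)
                   in IsDominant D P s′ d × regret s ℚ.≤ regret s′
  raise-critical {s} {d} s∈𝒮 d-dominant c =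
    firstArgmax-shift d-dominant Θ1-lift lift-d , regret-shift lift-P lift-opt
    where
    open CriticalTerm c
    open Raising D s∈𝒮 {start} {length} (endSegment-within segment (KPartition-r≤n P d))
    s′ = raise D start length
    Θ1-lift : ∀ i → Θ1 D (parts i) s′ ℚ.≤ Θ1 D (parts i) s + Δ
    Θ1-lift i = Θ1-shift D Δ-nonneg raise-sumShift (parts i) (KPartition-r≤n P i)
    lift-d : Θ1 D (parts d) s + Δ ℚ.≤ Θ1 D (parts d) s′
    lift-d = begin
      Θ1 D (parts d) s + Δ                      ≤⟨ ℚₚ.+-monoˡ-≤ Δ ≤-term ⟩
      (offset + sumFrom s start length) + Δ     ≡⟨ ℚₚ.+-assoc offset _ Δ ⟩
      offset + (sumFrom s start length + Δ)     ≡⟨ cong (offset +_) raise-sum-window ⟨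
      offset + sumFrom s′ start length          ≤⟨ term-≤ s′ ⟩
      Θ1 D (parts d) s′                         ∎
    lift-P : Θk D P s + Δ ℚ.≤ Θk D P s′
    lift-P = begin
      Θk D P s + Δ          ≤⟨ ℚₚ.+-monoˡ-≤ Δ (maxFin-lub (suc m) _ (Θ1-nonneg D (parts d) s) (proj₁ d-dominant)) ⟩
      Θ1 D (parts d) s + Δ  ≤⟨ lift-d ⟩
      Θ1 D (parts d) s′     ≤⟨ maxFin-ub (suc m) (λ i → Θ1 D (parts i) s′) d ⟩
      Θk D P s′             ∎
    lift-opt : Θopt s′ ℚ.≤ Θopt s + Δ
    lift-opt = ℚₚ.≤-trans (optimum-minimal s′ (optimum s)) (Θk-shift D Δ-nonneg raise-sumShift (optimum s))

  record Improvement (s : Scenario) : Set where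
    field
      start        : ℕ
      length       : ℕ
      within       : start ℕ.+ length ≤ suc n
      dominant     : Fin (suc m)
      isDominant   : IsDominant D P (raise D start length) dominant
      concentrated : IsConcentratedOn D (raise D start length) (parts dominant)
      regret-≤     : regret s ℚ.≤ regret (raise D start length)

  improve : ∀ {s} → IsScenario D s → Improvement s
  improve {s} s∈𝒮 = record
    { start        = start
    ; length       = length
    ; within       = endSegment-within segment (KPartition-r≤n P d)
    ; dominant     = d
    ; isDominant   = proj₁ raised
    ; concentrated = raise-concentrated D segment
    ; regret-≤     = proj₂ raised
    }
    where
    dominantPart : Σ (Fin (suc m)) (IsDominant D P s)
    dominantPart = firstArgmax m (λ i → Θ1 D (parts i) s)
    d = proj₁ dominantPart
    c = criticalTerm D (parts d) s
    open CriticalTerm c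
    raised = raise-critical s∈𝒮 (proj₂ dominantPart) c

  windows : List (ℕ × ℕ)
  windows = cartesianProduct (upTo (suc (suc n))) (upTo (suc (suc n)))

  raisedRegret : ℕ × ℕ → ℚ
  raisedRegret (a , L) = regret (raise D a L)

  worstWindow : ℕ × ℕ
  worstWindow = argmax raisedRegret (0 , 0) windows

  worstRaise : Scenario
  worstRaise = raise D (proj₁ worstWindow) (proj₂ worstWindow)

  worstRaise-isScenario : IsScenario D worstRaise
  worstRaise-isScenario = raise-isScenario D V (proj₁ worstWindow) (proj₂ worstWindow)

  worstRaise-maximal : ∀ s → IsScenario D s → regret s ℚ.≤ regret worstRaise
  worstRaise-maximal s s∈𝒮 = ℚₚ.≤-trans regret-≤
    (All.lookup (f[xs]≤f[argmax] {f = raisedRegret} (0 , 0) windows)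
      (∈-cartesianProduct⁺ (∈-upTo⁺ (s≤s a≤1+n)) (∈-upTo⁺ (s≤s L≤1+n))))
    where
    open Improvement (improve s∈𝒮)
    a≤1+n = ℕₚ.≤-trans (ℕₚ.m≤m+n start length) within
    L≤1+n = ℕₚ.≤-trans (ℕₚ.m≤n+m length start) within

theorem1 : (n m : ℕ) (D : Data n) → Valid D → (P : KPartition n m) →
    Σ Scenario λ s* → IsWorstCase D P s* ×
      Σ (Fin (suc m)) λ d → IsDominant D P s* d ×
        ((∀ i → i ≤ n →
            (i < Part.l (KPartition.parts P d) ⊎ Part.r (KPartition.parts P d) < i) →
            s* i ≡ Data.w⁻ D i) ×
         (LeftDominant D s* (Part.l (KPartition.parts P d)) (Part.r (KPartition.parts P d))
          ⊎ RightDominant D s* (Part.l (KPartition.parts P d)) (Part.r (KPartition.parts P d))))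
theorem1 n m D V P = raise D start length , worstCase , dominant , isDominant , concentrated
  where
  open WorstCase D V P
  open Improvement (improve worstRaise-isScenario)
  worstCase : IsWorstCase D P (raise D start length)
  worstCase = isWorstCase (raise-isScenario D V start length)
                (λ s s∈𝒮 → ℚₚ.≤-trans (worstRaise-maximal s s∈𝒮) regret-≤)
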